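{- Let $p$ be an odd prime, $q=p^{n}$, and $F=\mathrm{GF}(q)=\{a_{0}=0,a_{1},\dots,a_{q-1}\}$. For $c\in F$ let $f_{c}:F\to F$, $f_{c}(x)=c+x^{2}$, and let $M(f_{c})$ be the $q\times q$ matrix over $F$, with rows and columns indexed by the elements of $F$, whose $(a,b)$ entry is $f_{c}(b-a)$. Let $H$ be the $q^{2}\times q^{2}$ block matrix $H=[H_{i,m}]_{0\le i,m\le q-1}$ whose $(i,m)$ block is $H_{i,m}=M(f_{a_{i}a_{m}})$ (so in particular the blocks in block-row $0$ and block-column $0$ are all $M(f_{0})$). Then $H$ is a $\mathrm{GH}(q,q)$ over the additive group of $F$.
   Context: For a finite additive abelian group $U$ of order $u$ and a positive integer $\lambda$, a generalized Hadamard matrix $\mathrm{GH}(u,\lambda)$ over $U$ is a square matrix $[d_{ij}]$ of order $u\lambda$ with entries in $U$ such that for any two distinct rows $i\neq \ell$, the multiset $\{d_{ij}-d_{\ell j}: 1\le j\le u\lambda\}$ contains each element of $U$ exactly $\lambda$ times. -}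

module Defs where

open import Level using (Level; _⊔_) renaming (suc to lsuc)
open import Data.Nat using (ℕ; zero; suc) renaming (_*_ to _*ℕ_)
open import Data.Fin using (Fin; zero; suc; remQuot)
open import Data.Product using (∃; _×_; _,_; proj₁; proj₂)
open import Relation.Nullary using (¬_; yes; no)
open import Relation.Binary.PropositionalEquality using (_≡_; _≢_)
open import Relation.Binary.Definitions using (Decidable)
open import Relation.Unary using (Pred) renaming (Decidable to DecidableU)
open import Algebra.Bundles using (AbelianGroup; CommutativeRing)

count : ∀ {p} {n : ℕ} {P : Pred (Fin n) p} → DecidableU P → ℕ
count {n = zero}  P? = 0
count {n = suc n} P? with P? zero
... | yes _ = suc (count (λ j → P? (suc j)))
... | no  _ = count (λ j → P? (suc j))

HasOrder : ∀ {c ℓ} (U : AbelianGroup c ℓ) → ℕ → Set (c ⊔ ℓ)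
HasOrder U u =
  ∃ λ (e : Fin u → Carrier) →
    (∀ i j → e i ≈ e j → i ≡ j) × (∀ x → ∃ λ i → e i ≈ x)
  where open AbelianGroup U

IsGH : ∀ {c ℓ} (U : AbelianGroup c ℓ) →
       Decidable (AbelianGroup._≈_ U) →
       (u λ' : ℕ) → (Fin (u *ℕ λ') → Fin (u *ℕ λ') → AbelianGroup.Carrier U) →
       Set (c ⊔ ℓ)
IsGH U _≟_ u λ' d =
  HasOrder U u ×
  (∀ (i l : Fin (u *ℕ λ')) → i ≢ l → ∀ (g : Carrier) →
     count (λ j → (d i j ∙ (d l j)⁻¹) ≟ g) ≡ λ')
  where open AbelianGroup U

record FiniteField c ℓ : Set (lsuc (c ⊔ ℓ)) where
  field
    commRing : CommutativeRing c ℓ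
  open CommutativeRing commRing public hiding (ring)
  field
    0≉1      : ¬ (0# ≈ 1#)
    inverse  : ∀ x → ¬ (x ≈ 0#) → ∃ λ y → x * y ≈ 1#
    _≟_      : Decidable _≈_
    order    : ℕ
    a        : Fin order → Carrier
    a-inj    : ∀ i j → a i ≈ a j → i ≡ j
    a-surj   : ∀ x → ∃ λ i → a i ≈ x

module _ {c ℓ} (F : FiniteField c ℓ) where
  open FiniteField F

  f : Carrier → Carrier → Carrier
  f cc x = cc + x * x

  M : Carrier → Fin order → Fin order → Carrier
  M cc x y = f cc (a y + - (a x))

  -- H = [H_{i,m}], H_{i,m} = M(f_{a_i a_m}); row index i*q + x
  -- corresponds to block-row i and row x inside the block (remQuot).
  H : Fin (order *ℕ order) → Fin (order *ℕ order) → Carrier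
  H r s = M (a (proj₁ (remQuot {order} order r)) * a (proj₁ (remQuot {order} order s)))
            (proj₂ (remQuot {order} order r)) (proj₂ (remQuot {order} order s))

module Submission where

-- Index rows of H by pairs (i, x) (block, position) and columns by (m, y).
-- The entry is a_i a_m + (a_y - a_x)², so for rows (i, x) ≠ (i′, x′):
--   * if i ≠ i′, the difference is (a_i - a_i′) a_m + (terms in y): for each
--     y it is affine in a_m with nonzero slope, hence hits every g once;
--   * if i = i′, then x ≠ x′ and by the difference of squares it equals
--     2(a_x′ - a_x) a_y + (terms in x, x′): for each m it is affine in a_y,
--     with nonzero slope because 2 ≠ 0 in a field of odd order.
-- Either way each g occurs exactly once per line of a q × q grid, i.e. q times.

open import Defs
open import Data.Nat using (ℕ; zero; suc; _^_; _%_; _<?_) renaming (_+_ to _+ℕ_; _*_ to _*ℕ_)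
import Data.Nat.Properties as ℕₚ
open import Data.Nat.DivMod using (%-distribˡ-*; m*n%n≡0)
open import Data.Nat.Primality using (Prime)
open import Data.Fin using (Fin; zero; suc; toℕ; combine; remQuot; _↑ˡ_; _↑ʳ_)
open import Data.Fin.Properties
  using (suc-injective; toℕ-injective; remQuot-combine; combine-remQuot) renaming (_≟_ to _≟-Fin_)
open import Data.Fin.Permutation using (Permutation; permutation)
open import Data.Product using (∃; _,_; proj₁; proj₂)
open import Data.Empty using (⊥-elim)
open import Relation.Nullary using (¬_; yes; no; Dec)
open import Relation.Unary using (Pred) renaming (Decidable to DecidableU)
open import Relation.Binary.Definitions using (tri<; tri≈; tri>)
open import Relation.Binary.PropositionalEquality as ≡ using (_≡_; _≢_; refl; module ≡-Reasoning)
open import Algebra.Bundles using (CommutativeRing)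
open import Algebra.Properties.CommutativeMonoid.Sum ℕₚ.+-0-commutativeMonoid
  using (sum; ∑-comm; ∑-distrib-+; sum-cong-≗; sum-permute)

double-even : ∀ k → (k +ℕ k) % 2 ≡ 0
double-even k = ≡.subst (λ m → m % 2 ≡ 0) k*2≡k+k (m*n%n≡0 k 2)
  where
  k*2≡k+k : k *ℕ 2 ≡ k +ℕ k
  k*2≡k+k = ≡.trans (ℕₚ.*-comm k 2) (≡.cong (k +ℕ_) (ℕₚ.+-identityʳ k))

odd-power : ∀ p n → p % 2 ≡ 1 → (p ^ n) % 2 ≡ 1
odd-power p zero    p-odd = refl
odd-power p (suc n) p-odd = begin
  (p *ℕ p ^ n) % 2               ≡⟨ %-distribˡ-* p (p ^ n) 2 ⟩
  ((p % 2) *ℕ (p ^ n % 2)) % 2   ≡⟨ ≡.cong₂ (λ u v → (u *ℕ v) % 2) p-odd (odd-power p n p-odd) ⟩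
  1                              ∎
  where open ≡-Reasoning

indicator : ∀ {p} {P : Set p} → Dec P → ℕ
indicator (yes _) = 1
indicator (no _)  = 0

count≡sum : ∀ {p n} {P : Pred (Fin n) p} (P? : DecidableU P) →
            count P? ≡ sum (λ j → indicator (P? j))
count≡sum {n = zero}  P? = refl
count≡sum {n = suc n} P? with P? zero
... | yes _ = ≡.cong suc (count≡sum (λ j → P? (suc j)))
... | no  _ = count≡sum (λ j → P? (suc j))

count-none : ∀ {p n} {P : Pred (Fin n) p} (P? : DecidableU P) →
             (∀ j → ¬ P j) → count P? ≡ 0
count-none {n = zero}  P? none = refl
count-none {n = suc n} P? none with P? zero
... | yes p₀ = ⊥-elim (none zero p₀)
... | no  _  = count-none (λ j → P? (suc j)) (λ j → none (suc j))

count-unique : ∀ {p n} {P : Pred (Fin n) p} (P? : DecidableU P) →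
               ∃ P → (∀ j j′ → P j → P j′ → j ≡ j′) → count P? ≡ 1
count-unique {n = suc n} P? (j , pj) unique with P? zero
... | yes p₀ = ≡.cong suc (count-none (λ j → P? (suc j)) (λ j pj′ → zero≢suc (unique _ _ p₀ pj′)))
  where
  zero≢suc : ∀ {j : Fin n} → zero ≢ suc j
  zero≢suc ()
count-unique {n = suc n} P? (zero  , pj) unique | no ¬p₀ = ⊥-elim (¬p₀ pj)
count-unique {n = suc n} P? (suc j , pj) unique | no ¬p₀ =
  count-unique (λ j → P? (suc j)) (j , pj) (λ i i′ pi pi′ → suc-injective (unique _ _ pi pi′))

sum-ones : ∀ n → sum {n} (λ _ → 1) ≡ n
sum-ones zero    = refl
sum-ones (suc n) = ≡.cong suc (sum-ones n)

sum-++ : ∀ k m (f : Fin (k +ℕ m) → ℕ) →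
         sum f ≡ sum (λ j → f (j ↑ˡ m)) +ℕ sum (λ j → f (k ↑ʳ j))
sum-++ zero    m f = refl
sum-++ (suc k) m f = ≡.trans (≡.cong (f zero +ℕ_) (sum-++ k m (λ j → f (suc j))))
                           (≡.sym (ℕₚ.+-assoc (f zero) _ _))

sum-grid : ∀ m n (f : Fin (m *ℕ n) → ℕ) →
           sum f ≡ sum (λ i → sum (λ j → f (combine {m} {n} i j)))
sum-grid zero    n f = refl
sum-grid (suc m) n f = ≡.trans (sum-++ n (m *ℕ n) f)
  (≡.cong (sum (λ j → f (j ↑ˡ (m *ℕ n))) +ℕ_) (sum-grid m n (λ s → f (n ↑ʳ s))))

module Grid {p m n} {P : Pred (Fin (m *ℕ n)) p} (P? : DecidableU P) where
  open ≡-Reasoning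

  cell : Fin m → Fin n → ℕ
  cell i j = indicator (P? (combine {m} i j))

  count-grid : count P? ≡ sum (λ i → sum (cell i))
  count-grid = ≡.trans (count≡sum P?) (sum-grid m n _)

  count-rows : (∀ i → count (λ j → P? (combine {m} i j)) ≡ 1) → count P? ≡ m
  count-rows row = begin
    count P?                   ≡⟨ count-grid ⟩
    sum (λ i → sum (cell i))   ≡⟨ sum-cong-≗ (λ i → ≡.trans (≡.sym (count≡sum (λ j → P? (combine {m} i j))))
                                                          (row i)) ⟩
    sum {m} (λ _ → 1)          ≡⟨ sum-ones m ⟩
    m                          ∎

  count-columns : (∀ j → count (λ i → P? (combine {m} i j)) ≡ 1) → count P? ≡ n
  count-columns column = begin
    count P?                             ≡⟨ count-grid ⟩
    sum (λ i → sum (cell i))             ≡⟨ ∑-comm cell ⟩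
    sum (λ j → sum (λ i → cell i j))     ≡⟨ sum-cong-≗ (λ j → ≡.trans (≡.sym (count≡sum (λ i → P? (combine {m} i j))))
                                                                    (column j)) ⟩
    sum {n} (λ _ → 1)                    ≡⟨ sum-ones n ⟩
    n                                    ∎

-- A fixed-point-free involution σ of Fin n pairs every j with σ j ≠ j, so n
-- is twice the number of j with j < σ j.
involution-even : ∀ {n} (σ : Fin n → Fin n) → (∀ j → σ (σ j) ≡ j) → (∀ j → σ j ≢ j) →
                  ∃ λ k → n ≡ k +ℕ k
involution-even {n} σ σσ σ-free = below , (begin
  n                                        ≡⟨ ≡.sym (sum-ones n) ⟩
  sum {n} (λ _ → 1)                        ≡⟨ sum-cong-≗ (λ j → ≡.sym (split j)) ⟩
  sum {n} (λ j → ascent j +ℕ ascent (σ j)) ≡⟨ ∑-distrib-+ ascent (λ j → ascent (σ j)) ⟩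
  below +ℕ sum {n} (λ j → ascent (σ j))    ≡⟨ ≡.cong (below +ℕ_) (≡.sym (sum-permute ascent π)) ⟩
  below +ℕ below                           ∎)
  where
  open ≡-Reasoning
  ascent : Fin n → ℕ
  ascent j = indicator (toℕ j <? toℕ (σ j))
  below : ℕ
  below = sum ascent
  π : Permutation n n
  π = permutation σ σ σσ σσ
  -- exactly one of j < σ j and σ j < σ (σ j) = j holds
  split : ∀ j → ascent j +ℕ ascent (σ j) ≡ 1
  split j rewrite σσ j with toℕ j <? toℕ (σ j) | toℕ (σ j) <? toℕ j
  ... | yes j<σj | yes σj<j = ⊥-elim (ℕₚ.<-asym j<σj σj<j)
  ... | yes _    | no  _    = refl
  ... | no  _    | yes _    = refl
  ... | no  j≮σj | no  σj≮j with ℕₚ.<-cmp (toℕ j) (toℕ (σ j))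
  ...   | tri< j<σj _ _ = ⊥-elim (j≮σj j<σj)
  ...   | tri≈ _ j≡σj _ = ⊥-elim (σ-free j (≡.sym (toℕ-injective j≡σj)))
  ...   | tri> _ _ σj<j = ⊥-elim (σj≮j σj<j)

module RingIdentities {c ℓ} (R : CommutativeRing c ℓ) where
  open CommutativeRing R
  open import Relation.Binary.Reasoning.Setoid setoid
  open import Algebra.Properties.Group +-group using (⁻¹-involutive)
  open import Algebra.Properties.AbelianGroup +-abelianGroup using (⁻¹-∙-comm)
  open import Algebra.Properties.CommutativeSemigroup +-commutativeSemigroup using (interchange)
  open import Algebra.Properties.Ring ring using ([y-z]x≈yx-zx)

  difference-of-sums : ∀ p u q v → (p + u) - (q + v) ≈ (p - q) + (u - v)
  difference-of-sums p u q v = begin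
    (p + u) + - (q + v)   ≈⟨ +-congˡ (sym (⁻¹-∙-comm q v)) ⟩
    (p + u) + (- q + - v) ≈⟨ interchange p u (- q) (- v) ⟩
    (p - q) + (u - v)     ∎

  telescope : ∀ p q r → (p - q) + (q - r) ≈ p - r
  telescope p q r = begin
    (p + - q) + (q + - r) ≈⟨ +-assoc p (- q) (q + - r) ⟩
    p + (- q + (q + - r)) ≈⟨ +-congˡ (sym (+-assoc (- q) q (- r))) ⟩
    p + ((- q + q) + - r) ≈⟨ +-congˡ (+-congʳ (-‿inverseˡ q)) ⟩
    p + (0# + - r)        ≈⟨ +-congˡ (+-identityˡ (- r)) ⟩
    p - r                 ∎

  difference-of-squares : ∀ u v → u * u - v * v ≈ (u - v) * (u + v)
  difference-of-squares u v = sym (begin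
    (u - v) * (u + v)                 ≈⟨ distribˡ (u - v) u v ⟩
    (u - v) * u + (u - v) * v         ≈⟨ +-cong ([y-z]x≈yx-zx u u v) ([y-z]x≈yx-zx v u v) ⟩
    (u * u - v * u) + (u * v - v * v) ≈⟨ +-congʳ (+-congˡ (-‿cong (*-comm v u))) ⟩
    (u * u - u * v) + (u * v - v * v) ≈⟨ telescope (u * u) (u * v) (v * v) ⟩
    u * u - v * v                     ∎)

  difference-of-affine : ∀ p q s u v → (p * s + u) - (q * s + v) ≈ (p - q) * s + (u - v)
  difference-of-affine p q s u v = begin
    (p * s + u) - (q * s + v)   ≈⟨ difference-of-sums (p * s) u (q * s) v ⟩
    (p * s - q * s) + (u - v)   ≈⟨ +-congʳ ([y-z]x≈yx-zx s p q) ⟨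
    (p - q) * s + (u - v)       ∎

  double : ∀ k → (1# + 1#) * k ≈ k + k
  double k = trans (distribʳ k 1# 1#) (+-cong (*-identityˡ k) (*-identityˡ k))

  difference-of-shifts : ∀ y x x′ → (y - x) - (y - x′) ≈ x′ - x
  difference-of-shifts y x x′ = begin
    (y - x) - (y - x′)     ≈⟨ difference-of-sums y (- x) y (- x′) ⟩
    (y - y) + (- x - - x′) ≈⟨ +-cong (-‿inverseʳ y) (+-congˡ (⁻¹-involutive x′)) ⟩
    0# + (- x + x′)        ≈⟨ +-identityˡ (- x + x′) ⟩
    - x + x′               ≈⟨ +-comm (- x) x′ ⟩
    x′ - x                 ∎

  squares-differ-affinely : ∀ y x x′ →
    (y - x) * (y - x) - (y - x′) * (y - x′) ≈
    ((x′ - x) + (x′ - x)) * y + (x′ - x) * (- x + - x′)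
  squares-differ-affinely y x x′ = begin
    (y - x) * (y - x) - (y - x′) * (y - x′)
      ≈⟨ difference-of-squares (y - x) (y - x′) ⟩
    ((y - x) - (y - x′)) * ((y - x) + (y - x′))
      ≈⟨ *-cong (difference-of-shifts y x x′) (interchange y (- x) y (- x′)) ⟩
    (x′ - x) * ((y + y) + (- x + - x′))
      ≈⟨ distribˡ (x′ - x) (y + y) (- x + - x′) ⟩
    (x′ - x) * (y + y) + (x′ - x) * (- x + - x′)
      ≈⟨ +-congʳ (trans (distribˡ (x′ - x) y y) (sym (distribʳ y (x′ - x) (x′ - x)))) ⟩
    ((x′ - x) + (x′ - x)) * y + (x′ - x) * (- x + - x′) ∎

module FiniteFieldFacts {c ℓ} (F : FiniteField c ℓ) where
  open FiniteField F
  open import Relation.Binary.Reasoning.Setoid setoid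
  open import Algebra.Properties.Group +-group using (∙-cancelˡ; ∙-cancelʳ; //-rightDividesˡ; x∙y⁻¹≈ε⇒x≈y)

  *-cancelˡ-nonzero : ∀ {k} → ¬ k ≈ 0# → ∀ s t → k * s ≈ k * t → s ≈ t
  *-cancelˡ-nonzero {k} k≉0 s t ks≈kt = begin
    s             ≈⟨ undo s ⟨
    w * (k * s)   ≈⟨ *-congˡ ks≈kt ⟩
    w * (k * t)   ≈⟨ undo t ⟩
    t             ∎
    where
    w : Carrier
    w = proj₁ (inverse k k≉0)
    undo : ∀ x → w * (k * x) ≈ x
    undo x = begin
      w * (k * x) ≈⟨ *-assoc w k x ⟨
      (w * k) * x ≈⟨ *-congʳ (*-comm w k) ⟩
      (k * w) * x ≈⟨ *-congʳ (proj₂ (inverse k k≉0)) ⟩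
      1# * x      ≈⟨ *-identityˡ x ⟩
      x           ∎

  *-nonzero : ∀ {u v} → ¬ u ≈ 0# → ¬ v ≈ 0# → ¬ u * v ≈ 0#
  *-nonzero {u} {v} u≉0 v≉0 uv≈0 =
    v≉0 (*-cancelˡ-nonzero u≉0 v 0# (trans uv≈0 (sym (zeroʳ u))))

  difference-nonzero : ∀ {x y} → ¬ x ≈ y → ¬ x - y ≈ 0#
  difference-nonzero {x} {y} x≉y x-y≈0 = x≉y (x∙y⁻¹≈ε⇒x≈y x y x-y≈0)

  affine-count : ∀ {k K} → ¬ k ≈ 0# → (D : Fin order → Carrier) →
                 (∀ j → D j ≈ k * a j + K) → ∀ g → count (λ j → D j ≟ g) ≡ 1
  affine-count {k} {K} k≉0 D affine g = count-unique (λ j → D j ≟ g) solution unique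
    where
    w : Carrier
    w = proj₁ (inverse k k≉0)
    solution : ∃ λ j → D j ≈ g
    solution with a-surj (w * (g - K))
    ... | j , aj≈ = j , (begin
      D j                   ≈⟨ affine j ⟩
      k * a j + K           ≈⟨ +-congʳ (*-congˡ aj≈) ⟩
      k * (w * (g - K)) + K ≈⟨ +-congʳ (*-assoc k w (g - K)) ⟨
      (k * w) * (g - K) + K ≈⟨ +-congʳ (*-congʳ (proj₂ (inverse k k≉0))) ⟩
      1# * (g - K) + K      ≈⟨ +-congʳ (*-identityˡ (g - K)) ⟩
      (g - K) + K           ≈⟨ //-rightDividesˡ K g ⟩
      g                     ∎)
    unique : ∀ j j′ → D j ≈ g → D j′ ≈ g → j ≡ j′
    unique j j′ Dj≈g Dj′≈g = a-inj j j′ (*-cancelˡ-nonzero k≉0 (a j) (a j′)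
      (∙-cancelʳ K (k * a j) (k * a j′) (begin
        k * a j + K  ≈⟨ affine j ⟨
        D j          ≈⟨ trans Dj≈g (sym Dj′≈g) ⟩
        D j′         ≈⟨ affine j′ ⟩
        k * a j′ + K ∎)))

  -- In a field of odd order 1 + 1 ≠ 0: otherwise x ↦ x + 1 would be a
  -- fixed-point-free involution, forcing the order to be even.
  two≉0 : order % 2 ≡ 1 → ¬ (1# + 1#) ≈ 0#
  two≉0 odd 2≈0 = ℕₚ.1+n≢0 parity-clash
    where
    σ : Fin order → Fin order
    σ j = proj₁ (a-surj (a j + 1#))
    aσ : ∀ j → a (σ j) ≈ a j + 1#
    aσ j = proj₂ (a-surj (a j + 1#))
    σσ : ∀ j → σ (σ j) ≡ j
    σσ j = a-inj (σ (σ j)) j (begin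
      a (σ (σ j))       ≈⟨ aσ (σ j) ⟩
      a (σ j) + 1#      ≈⟨ +-congʳ (aσ j) ⟩
      (a j + 1#) + 1#   ≈⟨ +-assoc (a j) 1# 1# ⟩
      a j + (1# + 1#)   ≈⟨ +-congˡ 2≈0 ⟩
      a j + 0#          ≈⟨ +-identityʳ (a j) ⟩
      a j               ∎)
    σ-free : ∀ j → σ j ≢ j
    σ-free j σj≡j = 0≉1 (sym (∙-cancelˡ (a j) 1# 0# (begin
      a j + 1#   ≈⟨ aσ j ⟨
      a (σ j)    ≡⟨ ≡.cong a σj≡j ⟩
      a j        ≈⟨ +-identityʳ (a j) ⟨
      a j + 0#   ∎)))
    halves : ∃ λ k → order ≡ k +ℕ k
    halves = involution-even σ σσ σ-free
    parity-clash : 1 ≡ 0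
    parity-clash = ≡.trans (≡.sym odd)
      (≡.trans (≡.cong (_% 2) (proj₂ halves)) (double-even (proj₁ halves)))

module HadamardRows {c ℓ} (F : FiniteField c ℓ) where
  open FiniteField F
  open FiniteFieldFacts F
  open RingIdentities commRing
  open import Relation.Binary.Reasoning.Setoid setoid

  Index : Set
  Index = Fin (order *ℕ order)

  block inner : Index → Fin order
  block r = proj₁ (remQuot {order} order r)
  inner r = proj₂ (remQuot {order} order r)

  rows-determined : ∀ {r l} → block r ≡ block l → inner r ≡ inner l → r ≡ l
  rows-determined {r} {l} same-block same-inner =
    ≡.trans (≡.sym (combine-remQuot {order} order r))
      (≡.trans (≡.cong₂ combine same-block same-inner) (combine-remQuot {order} order l))

  shiftedSquare : Fin order → Fin order → Carrier
  shiftedSquare x y = (a y - a x) * (a y - a x)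

  H-entry : ∀ r m y → H F r (combine m y) ≡ a (block r) * a m + shiftedSquare (inner r) y
  H-entry r m y = ≡.cong (λ col → M F (a (block r) * a (proj₁ col)) (inner r) (proj₂ col))
                         (remQuot-combine m y)

  rowDifference : Index → Index → Index → Carrier
  rowDifference r l s = H F r s - H F l s

  across-blocks : ∀ r l m y → rowDifference r l (combine m y) ≈
    (a (block r) - a (block l)) * a m + (shiftedSquare (inner r) y - shiftedSquare (inner l) y)
  across-blocks r l m y = begin
    rowDifference r l (combine m y)
      ≡⟨ ≡.cong₂ _-_ (H-entry r m y) (H-entry l m y) ⟩
    (a (block r) * a m + shiftedSquare (inner r) y) - (a (block l) * a m + shiftedSquare (inner l) y)
      ≈⟨ difference-of-affine (a (block r)) (a (block l)) (a m) _ _ ⟩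
    (a (block r) - a (block l)) * a m + (shiftedSquare (inner r) y - shiftedSquare (inner l) y) ∎

  within-block : ∀ {r l} → block r ≡ block l → ∀ m y →
    let x = a (inner r) ; x′ = a (inner l) in
    rowDifference r l (combine m y) ≈ ((x′ - x) + (x′ - x)) * a y + (x′ - x) * (- x + - x′)
  within-block {r} {l} same-block m y = begin
    rowDifference r l (combine m y)
      ≡⟨ ≡.cong₂ _-_ (H-entry r m y) entry-l ⟩
    (t + S) - (t + S′)   ≈⟨ difference-of-sums t S t S′ ⟩
    (t - t) + (S - S′)   ≈⟨ +-congʳ (-‿inverseʳ t) ⟩
    0# + (S - S′)        ≈⟨ +-identityˡ (S - S′) ⟩
    S - S′               ≈⟨ squares-differ-affinely (a y) (a (inner r)) (a (inner l)) ⟩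
    ((a (inner l) - a (inner r)) + (a (inner l) - a (inner r))) * a y
      + (a (inner l) - a (inner r)) * (- a (inner r) + - a (inner l)) ∎
    where
    t S S′ : Carrier
    t  = a (block r) * a m
    S  = shiftedSquare (inner r) y
    S′ = shiftedSquare (inner l) y
    entry-l : H F l (combine m y) ≡ t + S′
    entry-l = ≡.trans (H-entry l m y) (≡.cong (λ b → a b * a m + S′) (≡.sym same-block))

  differs-by? : ∀ r l g s → Dec (rowDifference r l s ≈ g)
  differs-by? r l g s = rowDifference r l s ≟ g

  -- Two distinct rows differ by each g exactly q times: within every column
  -- position (different blocks) or every block column (same block) the
  -- difference is a bijection onto F.
  rows-balanced : order % 2 ≡ 1 → ∀ r l → r ≢ l → ∀ g →
                  count (differs-by? r l g) ≡ order
  rows-balanced odd r l r≢l g with block r ≟-Fin block l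
  ... | no  blocks-differ = Grid.count-columns {m = order} (differs-by? r l g) (λ y →
        affine-count slope≉0 _ (λ m → across-blocks r l m y) g)
    where
    slope≉0 : ¬ a (block r) - a (block l) ≈ 0#
    slope≉0 = difference-nonzero (λ e → blocks-differ (a-inj _ _ e))
  ... | yes same-block    = Grid.count-rows {m = order} (differs-by? r l g) (λ m →
        affine-count slope≉0 _ (within-block same-block m) g)
    where
    slope≉0 : ¬ (a (inner l) - a (inner r)) + (a (inner l) - a (inner r)) ≈ 0#
    slope≉0 e = *-nonzero (two≉0 odd)
      (difference-nonzero (λ e′ → r≢l (rows-determined same-block (≡.sym (a-inj _ _ e′)))))
      (trans (double _) e)

  H-is-GH : order % 2 ≡ 1 → IsGH +-abelianGroup _≟_ order order (H F)
  H-is-GH odd = (a , a-inj , a-surj) , rows-balanced odd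

theorem3p1 : ∀ {c ℓ} (F : FiniteField c ℓ) (p n : ℕ) →
  Prime p → p % 2 ≡ 1 →
  FiniteField.order F ≡ p ^ n →
  (∀ (i : Fin (FiniteField.order F)) → toℕ i ≡ 0 →
     FiniteField._≈_ F (FiniteField.a F i) (FiniteField.0# F)) →
  IsGH (CommutativeRing.+-abelianGroup (FiniteField.commRing F)) (FiniteField._≟_ F)
    (FiniteField.order F) (FiniteField.order F) (H F)
theorem3p1 F p n _ p-odd order≡p^n _ = HadamardRows.H-is-GH F order-odd
  where
  order-odd : FiniteField.order F % 2 ≡ 1
  order-odd = ≡.subst (λ q → q % 2 ≡ 1) (≡.sym order≡p^n) (odd-power p n p-odd)
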